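{- For all integers $n\ge m\ge 4$, $\mathrm{opt}^{P}_{W}(G_{n,m}) = \lceil (m-2)/2\rceil$. For $m=3$ and $n\ge 3$, $\mathrm{opt}^{P}_{W}(G_{n,3})=1$. For $m\le 2$ and $n\ge m$, $\mathrm{opt}^{P}_{W}(G_{n,m})=0$.
   Context: $G_{n,m}$ is the rectangular grid with $n$ rows and $m$ columns, squares $(i,j)$. A wall is a unit segment separating two adjacent squares; the grid boundary also acts as a wall. A robot starts on $(1,1)$. A move: choose one of the four directions; the robot slides and stops on the last square before it would cross a wall or leave the grid. The robot passes over every square it occupies during a move. A set of walls is a solution of the wall/pass game if every square is passed over during some sequence of moves from $(1,1)$. $\mathrm{opt}^{P}_{W}(G_{n,m})$ is the minimum number of walls in such a solution. -}

module Defs where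

open import Data.Nat using (ℕ; zero; suc; _≤_; _<_; pred; ⌈_/2⌉; _∸_)
open import Data.Product using (Σ; _×_; _,_)
open import Data.Sum using (_⊎_)
open import Data.List using (List; length)
open import Data.List.Membership.Propositional using (_∈_)
open import Data.List.Relation.Unary.All using (All)
open import Data.List.Relation.Unary.Unique.Propositional using (Unique)
open import Relation.Binary.PropositionalEquality using (_≡_)
open import Relation.Nullary using (¬_)

-- Squares are (i , j) with 1 ≤ i ≤ n (row), 1 ≤ j ≤ m (column).
Square : Set
Square = ℕ × ℕ

-- A wall (interior unit segment between two adjacent squares).
--   hor i j : between (i , j) and (i+1 , j)
--   ver i j : between (i , j) and (i , j+1)
data Wall : Set where
  hor : ℕ → ℕ → Wall
  ver : ℕ → ℕ → Wall

ValidWall : ℕ → ℕ → Wall → Set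
ValidWall n m (hor i j) = (1 ≤ i × i < n) × (1 ≤ j × j ≤ m)
ValidWall n m (ver i j) = (1 ≤ i × i ≤ n) × (1 ≤ j × j < m)

WallSet : ℕ → ℕ → List Wall → Set
WallSet n m W = Unique W × All (ValidWall n m) W

data Dir : Set where
  up down left right : Dir

Blocked : ℕ → ℕ → List Wall → Dir → Square → Set
Blocked n m W up    (i , j) = i ≡ 1 ⊎ hor (pred i) j ∈ W
Blocked n m W down  (i , j) = i ≡ n ⊎ hor i j ∈ W
Blocked n m W left  (i , j) = j ≡ 1 ⊎ ver i (pred j) ∈ W
Blocked n m W right (i , j) = j ≡ m ⊎ ver i j ∈ W

step : Dir → Square → Square
step up    (i , j) = (pred i , j)
step down  (i , j) = (suc i , j)
step left  (i , j) = (i , pred j)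
step right (i , j) = (i , suc j)

data Slide (n m : ℕ) (W : List Wall) (d : Dir) : Square → Square → Set where
  stop : ∀ {p} → Blocked n m W d p → Slide n m W d p p
  go   : ∀ {p q} → ¬ Blocked n m W d p → Slide n m W d (step d p) q → Slide n m W d p q

data Passes (n m : ℕ) (W : List Wall) (d : Dir) : Square → Square → Set where
  here  : ∀ {p} → Passes n m W d p p
  there : ∀ {p s} → ¬ Blocked n m W d p → Passes n m W d (step d p) s → Passes n m W d p s

data Reach (n m : ℕ) (W : List Wall) : Square → Set where
  start : Reach n m W (1 , 1)
  move  : ∀ {p q} (d : Dir) → Reach n m W p → Slide n m W d p q → Reach n m W q

PassedOver : ℕ → ℕ → List Wall → Square → Set
PassedOver n m W s = Σ Square λ p → Σ Dir λ d → Reach n m W p × Passes n m W d p s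

Solution : ℕ → ℕ → List Wall → Set
Solution n m W = ∀ i j → 1 ≤ i → i ≤ n → 1 ≤ j → j ≤ m → PassedOver n m W (i , j)

OptPW≡ : ℕ → ℕ → ℕ → Set
OptPW≡ n m k =
  (Σ (List Wall) λ W → WallSet n m W × Solution n m W × length W ≡ k)
  × (∀ W → WallSet n m W → Solution n m W → k ≤ length W)

module Submission where

open import Defs
open import Data.Nat using (ℕ; _≤_; ⌈_/2⌉; _∸_)
open import Data.Product using (_×_)

open import Data.Nat using (zero; suc; _+_; _<_; _≟_; _≤?_; z≤n; s≤s; _≤‴_; ≤‴-refl; ≤‴-step; z<s)
open import Data.Nat.Properties
open import Data.Bool using (Bool; true; false; not)
open import Data.List using (List; []; _∷_; length; filter)
open import Data.List.Properties using (filter-notAll)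
open import Data.List.Relation.Unary.Any as Any using (Any; here; there)
open import Relation.Unary using (Decidable; ∁)
open import Data.List.Membership.Propositional using (_∈_; _∉_)
open import Data.List.Membership.Propositional.Properties using (∈-filter⁺)
open import Data.List.Membership.DecPropositional _≟_ using (_∈?_)
open import Data.List.Relation.Unary.All as All using ([])
open import Data.List.Relation.Unary.Unique.Propositional using (Unique; []; _∷_)
open import Data.Product using (Σ; _,_; proj₁; proj₂)
open import Data.Sum using (_⊎_; inj₁; inj₂; [_,_])
open import Relation.Nullary using (¬_; yes; no; ¬?; _×-dec_; contradiction)
open import Relation.Binary.Definitions using (tri<; tri≈; tri>)
open import Relation.Binary.PropositionalEquality using (_≡_; _≢_; refl; sym; cong; subst)

-- A move stops only beside the boundary or a wall, so every
-- reachable square lies on a "stop row" (1, n, or a row next to a horizontal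
-- wall) and a "stop column".  A square passed over lies on the line of the
-- move's start, hence an interior square (i, j) is passed over only if row i
-- is next to a horizontal wall or column j is next to a vertical one.  If one
-- interior column is not, all n - 2 ≥ m - 2 interior rows are; otherwise all
-- m - 2 interior columns are.  Each wall borders two lines, so m - 2 ≤ 2|W|.
--
-- With no horizontal walls, a column reached at its top or
-- bottom is swept entirely and both ends are reachable.  The staircase of
-- t = ⌈(m-2)/2⌉ vertical walls, the s-th one right of column 2s in the top
-- row for odd s and the bottom row for even s, lets the robot reach every
-- column at the top or bottom.  For m ≤ 2 no wall is needed.

wallCols : List Wall → List ℕ
wallCols []            = []
wallCols (hor _ _ ∷ W) = wallCols W
wallCols (ver _ k ∷ W) = k ∷ suc k ∷ wallCols W

wallRows : List Wall → List ℕ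
wallRows []            = []
wallRows (hor k _ ∷ W) = k ∷ suc k ∷ wallRows W
wallRows (ver _ _ ∷ W) = wallRows W

-- 2s, defined by recursion so that twice (suc s) computes to suc (suc (twice s)).
twice : ℕ → ℕ
twice zero    = zero
twice (suc s) = suc (suc (twice s))

length-wallCols : ∀ W → length (wallCols W) ≤ twice (length W)
length-wallCols []            = z≤n
length-wallCols (hor _ _ ∷ W) = ≤-trans (length-wallCols W) (m≤n+m _ 2)
length-wallCols (ver _ _ ∷ W) = s≤s (s≤s (length-wallCols W))

length-wallRows : ∀ W → length (wallRows W) ≤ twice (length W)
length-wallRows []            = z≤n
length-wallRows (hor _ _ ∷ W) = s≤s (s≤s (length-wallRows W))
length-wallRows (ver _ _ ∷ W) = ≤-trans (length-wallRows W) (m≤n+m _ 2)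

ver∈⇒wallCols : ∀ {W i k} → ver i k ∈ W → k ∈ wallCols W × suc k ∈ wallCols W
ver∈⇒wallCols {ver _ _ ∷ W} (here refl) = here refl , there (here refl)
ver∈⇒wallCols {ver _ _ ∷ W} (there w) with ver∈⇒wallCols w
... | k∈ , sk∈ = there (there k∈) , there (there sk∈)
ver∈⇒wallCols {hor _ _ ∷ W} (there w) = ver∈⇒wallCols w

hor∈⇒wallRows : ∀ {W k j} → hor k j ∈ W → k ∈ wallRows W × suc k ∈ wallRows W
hor∈⇒wallRows {hor _ _ ∷ W} (here refl) = here refl , there (here refl)
hor∈⇒wallRows {hor _ _ ∷ W} (there w) with hor∈⇒wallRows w
... | k∈ , sk∈ = there (there k∈) , there (there sk∈)
hor∈⇒wallRows {ver _ _ ∷ W} (there w) = hor∈⇒wallRows w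

StopRow : ℕ → List Wall → ℕ → Set
StopRow n W i = i ≡ 1 ⊎ i ≡ n ⊎ i ∈ wallRows W

StopCol : ℕ → List Wall → ℕ → Set
StopCol m W j = j ≡ 1 ⊎ j ≡ m ⊎ j ∈ wallCols W

Along Across : Dir → Square → ℕ
Along up    = proj₁
Along down  = proj₁
Along left  = proj₂
Along right = proj₂
Across up    = proj₂
Across down  = proj₂
Across left  = proj₁
Across right = proj₁

StopAlong : ℕ → ℕ → List Wall → Dir → ℕ → Set
StopAlong n m W up    = StopRow n W
StopAlong n m W down  = StopRow n W
StopAlong n m W left  = StopCol m W
StopAlong n m W right = StopCol m W

StopAcross : ℕ → ℕ → List Wall → Dir → ℕ → Set
StopAcross n m W up    = StopCol m W
StopAcross n m W down  = StopCol m W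
StopAcross n m W left  = StopRow n W
StopAcross n m W right = StopRow n W

module _ {n m : ℕ} {W : List Wall} where

  blocked⇒stop : ∀ d q → Blocked n m W d q → StopAlong n m W d (Along d q)
  blocked⇒stop up    _           (inj₁ e) = inj₁ e
  blocked⇒stop up    (zero  , _) (inj₂ w) = inj₂ (inj₂ (proj₁ (hor∈⇒wallRows w)))
  blocked⇒stop up    (suc i , _) (inj₂ w) = inj₂ (inj₂ (proj₂ (hor∈⇒wallRows w)))
  blocked⇒stop down  _           (inj₁ e) = inj₂ (inj₁ e)
  blocked⇒stop down  _           (inj₂ w) = inj₂ (inj₂ (proj₁ (hor∈⇒wallRows w)))
  blocked⇒stop left  _           (inj₁ e) = inj₁ e
  blocked⇒stop left  (_ , zero)  (inj₂ w) = inj₂ (inj₂ (proj₁ (ver∈⇒wallCols w)))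
  blocked⇒stop left  (_ , suc j) (inj₂ w) = inj₂ (inj₂ (proj₂ (ver∈⇒wallCols w)))
  blocked⇒stop right _           (inj₁ e) = inj₂ (inj₁ e)
  blocked⇒stop right _           (inj₂ w) = inj₂ (inj₂ (proj₁ (ver∈⇒wallCols w)))

  passes-across : ∀ {d p s} → Passes n m W d p s → Across d s ≡ Across d p
  passes-across here = refl
  passes-across {up}    (there _ ps) = passes-across ps
  passes-across {down}  (there _ ps) = passes-across ps
  passes-across {left}  (there _ ps) = passes-across ps
  passes-across {right} (there _ ps) = passes-across ps

  slide⇒passes : ∀ {d p q} → Slide n m W d p q → Passes n m W d p q
  slide⇒passes (stop _)  = here
  slide⇒passes (go b sl) = there b (slide⇒passes sl)

  slide⇒blocked : ∀ {d p q} → Slide n m W d p q → Blocked n m W d q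
  slide⇒blocked (stop b)  = b
  slide⇒blocked (go _ sl) = slide⇒blocked sl

  passes⇒slide : ∀ {d p q} → Passes n m W d p q → Blocked n m W d q → Slide n m W d p q
  passes⇒slide here         b = stop b
  passes⇒slide (there b ps) e = go b (passes⇒slide ps e)

  reach-stops  : ∀ {p} → Reach n m W p → StopRow n W (proj₁ p) × StopCol m W (proj₂ p)
  across-stops : ∀ {d p s} → Reach n m W p → Passes n m W d p s → StopAcross n m W d (Across d s)

  reach-stops start = inj₁ refl , inj₁ refl
  reach-stops (move up r sl)    = blocked⇒stop up _ (slide⇒blocked sl) , across-stops r (slide⇒passes sl)
  reach-stops (move down r sl)  = blocked⇒stop down _ (slide⇒blocked sl) , across-stops r (slide⇒passes sl)
  reach-stops (move left r sl)  = across-stops r (slide⇒passes sl) , blocked⇒stop left _ (slide⇒blocked sl)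
  reach-stops (move right r sl) = across-stops r (slide⇒passes sl) , blocked⇒stop right _ (slide⇒blocked sl)

  across-stops {up}    r ps = subst (StopCol m W) (sym (passes-across ps)) (proj₂ (reach-stops r))
  across-stops {down}  r ps = subst (StopCol m W) (sym (passes-across ps)) (proj₂ (reach-stops r))
  across-stops {left}  r ps = subst (StopRow n W) (sym (passes-across ps)) (proj₁ (reach-stops r))
  across-stops {right} r ps = subst (StopRow n W) (sym (passes-across ps)) (proj₁ (reach-stops r))

interior-stop : ∀ {k X x} → 2 ≤ x → x < k → x ≡ 1 ⊎ x ≡ k ⊎ x ∈ X → x ∈ X
interior-stop (s≤s ()) _   (inj₁ refl)
interior-stop _        x<k (inj₂ (inj₁ refl)) = contradiction refl (<⇒≢ x<k)
interior-stop _        _   (inj₂ (inj₂ x∈))   = x∈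

interior-on-wall-line : ∀ {n m W} → Solution n m W → ∀ {i j} → 2 ≤ i → i < n → 2 ≤ j → j < m →
                        j ∈ wallCols W ⊎ i ∈ wallRows W
interior-on-wall-line sol {i} {j} 2≤i i<n 2≤j j<m
  with sol i j (≤-trans (s≤s z≤n) 2≤i) (<⇒≤ i<n) (≤-trans (s≤s z≤n) 2≤j) (<⇒≤ j<m)
... | _ , up    , r , ps = inj₁ (interior-stop 2≤j j<m (across-stops r ps))
... | _ , down  , r , ps = inj₁ (interior-stop 2≤j j<m (across-stops r ps))
... | _ , left  , r , ps = inj₂ (interior-stop 2≤i i<n (across-stops r ps))
... | _ , right , r , ps = inj₂ (interior-stop 2≤i i<n (across-stops r ps))

-- Pigeonhole: a list containing every number of [a, a + k) has length ≥ k.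
-- (Remove a, which occurs in the list, and recurse on [a + 1, a + k).)
range-count : ∀ a k (ys : List ℕ) → (∀ {x} → a ≤ x → x < a + k → x ∈ ys) → k ≤ length ys
range-count a zero    ys covers = z≤n
range-count a (suc k) ys covers =
  ≤-trans (s≤s (range-count (suc a) k rest covers-rest)) (filter-notAll a≢? ys a-occurs)
  where
    a≢? : Decidable (a ≢_)
    a≢? y = ¬? (a ≟ y)
    rest : List ℕ
    rest = filter a≢? ys
    a-occurs : Any (∁ (a ≢_)) ys
    a-occurs = Any.map (λ a≡y a≢y → a≢y a≡y) (covers ≤-refl (m<m+n a z<s))
    covers-rest : ∀ {x} → suc a ≤ x → x < suc a + k → x ∈ rest
    covers-rest {x} a<x x< =
      ∈-filter⁺ a≢? (covers (<⇒≤ a<x) (subst (x <_) (sym (+-suc a k)) x<)) (λ a≡x → <-irrefl a≡x a<x)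

ceil-twice : ∀ L → ⌈ twice L /2⌉ ≡ L
ceil-twice zero    = refl
ceil-twice (suc L) = cong suc (ceil-twice L)

half-bound : ∀ {k L} → k ≤ twice L → ⌈ k /2⌉ ≤ L
half-bound {k} {L} k≤ = subst (⌈ k /2⌉ ≤_) (ceil-twice L) (⌈n/2⌉-mono k≤)

lower-bound : ∀ n k W → 2 + k ≤ n → Solution n (2 + k) W → ⌈ k /2⌉ ≤ length W
lower-bound n k W 2+k≤n sol with anyUpTo? (λ c → 2 ≤? c ×-dec ¬? (c ∈? wallCols W)) (2 + k)
... | yes (c , c<m , 2≤c , c∉) =
  half-bound (≤-trans (range-count 2 k (wallRows W) rows-on-walls) (length-wallRows W))
  where
    rows-on-walls : ∀ {i} → 2 ≤ i → i < 2 + k → i ∈ wallRows W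
    rows-on-walls 2≤i i<2+k =
      [ (λ c∈ → contradiction c∈ c∉) , (λ i∈ → i∈) ]
        (interior-on-wall-line sol 2≤i (<-≤-trans i<2+k 2+k≤n) 2≤c c<m)
... | no ∄ = half-bound (≤-trans (range-count 2 k (wallCols W) cols-on-walls) (length-wallCols W))
  where
    cols-on-walls : ∀ {c} → 2 ≤ c → c < 2 + k → c ∈ wallCols W
    cols-on-walls {c} 2≤c c<m with c ∈? wallCols W
    ... | yes c∈ = c∈
    ... | no c∉  = contradiction (c , c<m , 2≤c , c∉) ∄

NoHor : List Wall → Set
NoHor W = ∀ {i j} → hor i j ∉ W

module _ {n m : ℕ} {W : List Wall} (noHor : NoHor W) {j : ℕ} where

  descend : ∀ {i k} → i ≤‴ k → k ≤ n → Passes n m W down (i , j) (k , j)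
  descend ≤‴-refl       _   = here
  descend (≤‴-step i<k) k≤n = there [ <⇒≢ (<-≤-trans (≤‴⇒≤ i<k) k≤n) , noHor ] (descend i<k k≤n)

  ascend : ∀ {i k} → 1 ≤ i → i ≤ k → Passes n m W up (k , j) (i , j)
  ascend {k = zero}  1≤i i≤0 = contradiction (≤-trans 1≤i i≤0) λ ()
  ascend {k = suc k} 1≤i i≤k+1 with m≤n⇒m<n∨m≡n i≤k+1
  ... | inj₂ refl      = here
  ... | inj₁ (s≤s i≤k) =
    there [ (λ k+1≡1 → <⇒≢ (≤-trans 1≤i i≤k) (sym (suc-injective k+1≡1))) , noHor ]
          (ascend {k = k} 1≤i i≤k)

rowOf : ℕ → Bool → ℕ
rowOf n true  = 1
rowOf n false = n

module _ {n m : ℕ} {W : List Wall} (noHor : NoHor W) (1≤n : 1 ≤ n) where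

  switch-row : ∀ b b' j → Reach n m W (rowOf n b , j) → Reach n m W (rowOf n b' , j)
  switch-row true  true  j r = r
  switch-row false false j r = r
  switch-row true  false j r = move down r (passes⇒slide (descend noHor (≤⇒≤‴ 1≤n) ≤-refl) (inj₁ refl))
  switch-row false true  j r = move up r (passes⇒slide (ascend noHor ≤-refl 1≤n) (inj₁ refl))

  sweep-column : ∀ b j → Reach n m W (rowOf n b , j) → ∀ i → 1 ≤ i → i ≤ n → PassedOver n m W (i , j)
  sweep-column true  j r i 1≤i i≤n = _ , down , r , descend noHor (≤⇒≤‴ 1≤i) i≤n
  sweep-column false j r i 1≤i i≤n = _ , up   , r , ascend noHor 1≤i i≤n

data Parity : ℕ → Set where
  even : ∀ s → Parity (twice s)
  odd  : ∀ s → Parity (suc (twice s))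

parity : ∀ j → Parity j
parity zero    = even zero
parity (suc j) with parity j
... | even s = odd s
... | odd s  = even (suc s)

twice-injective : ∀ {a b} → twice a ≡ twice b → a ≡ b
twice-injective {zero}  {zero}  e = refl
twice-injective {suc a} {suc b} e = cong suc (twice-injective (suc-injective (suc-injective e)))

twice≢odd : ∀ a b → twice a ≢ suc (twice b)
twice≢odd (suc a) (suc b) e = twice≢odd a b (suc-injective (suc-injective e))

twice-mono : ∀ {a b} → a ≤ b → twice a ≤ twice b
twice-mono z≤n     = z≤n
twice-mono (s≤s h) = s≤s (s≤s (twice-mono h))

twice-ceil : ∀ k → k ≤ twice ⌈ k /2⌉ × twice ⌈ k /2⌉ ≤ suc k
twice-ceil zero          = z≤n , z≤n
twice-ceil (suc zero)    = s≤s z≤n , ≤-refl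
twice-ceil (suc (suc k)) with twice-ceil k
... | lo , hi = s≤s (s≤s lo) , s≤s (s≤s hi)

ver-injective : ∀ {r k r' k'} → ver r k ≡ ver r' k' → r ≡ r' × k ≡ k'
ver-injective refl = refl , refl

isOdd : ℕ → Bool
isOdd zero    = false
isOdd (suc s) = not (isOdd s)

wallRow : ℕ → ℕ → ℕ
wallRow n s = rowOf n (isOdd s)

staircase : ℕ → ℕ → List Wall
staircase n zero    = []
staircase n (suc s) = ver (wallRow n (suc s)) (twice (suc s)) ∷ staircase n s

staircase-member : ∀ {n t w} → w ∈ staircase n t →
                   Σ ℕ λ s → 1 ≤ s × s ≤ t × w ≡ ver (wallRow n s) (twice s)
staircase-member {t = suc t} (here refl) = suc t , s≤s z≤n , ≤-refl , refl
staircase-member {t = suc t} (there w∈) with staircase-member w∈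
... | s , 1≤s , s≤t , refl = s , 1≤s , m≤n⇒m≤1+n s≤t , refl

staircase-has : ∀ {n s t} → 1 ≤ s → s ≤ t → ver (wallRow n s) (twice s) ∈ staircase n t
staircase-has {t = zero}  1≤s s≤0 = contradiction (≤-trans 1≤s s≤0) λ ()
staircase-has {s = s} {suc t} 1≤s s≤t+1 with s ≟ suc t
... | yes refl = here refl
... | no s≢t+1 = there (staircase-has 1≤s (≤-pred (≤∧≢⇒< s≤t+1 s≢t+1)))

staircase-noHor : ∀ {n t} → NoHor (staircase n t)
staircase-noHor w∈ with staircase-member w∈
... | _ , _ , _ , ()

no-odd-wall : ∀ {n t r b} → ver r (suc (twice b)) ∉ staircase n t
no-odd-wall {b = b} w∈ with staircase-member w∈
... | s , _ , _ , e = twice≢odd s b (sym (proj₂ (ver-injective e)))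

no-wrong-row : ∀ {n t} → n ≢ 1 → ∀ s → ver (wallRow n (suc s)) (twice s) ∉ staircase n t
no-wrong-row {n} n≢1 s w∈ with staircase-member w∈
... | s' , _ , _ , e with ver-injective e
... | row≡ , col≡ with twice-injective col≡
... | refl = opposite-rows (isOdd s) row≡
  where
    opposite-rows : ∀ b → rowOf n (not b) ≢ rowOf n b
    opposite-rows true  e = n≢1 e
    opposite-rows false e = n≢1 (sym e)

length-staircase : ∀ n t → length (staircase n t) ≡ t
length-staircase n zero    = refl
length-staircase n (suc t) = cong suc (length-staircase n t)

staircase-wallSet : ∀ n m t → 1 ≤ n → twice t < m → WallSet n m (staircase n t)
staircase-wallSet n m t 1≤n 2t<m = unique t , All.tabulate valid
  where
    unique : ∀ t → Unique (staircase n t)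
    unique zero    = []
    unique (suc t) = All.tabulate newest-fresh ∷ unique t
      where
        newest-fresh : ∀ {w} → w ∈ staircase n t → ver (wallRow n (suc t)) (twice (suc t)) ≢ w
        newest-fresh w∈ e with staircase-member w∈
        ... | s , _ , s≤t , refl = <⇒≢ (s≤s s≤t) (sym (twice-injective (proj₂ (ver-injective e))))
    row-bounds : ∀ b → 1 ≤ rowOf n b × rowOf n b ≤ n
    row-bounds true  = ≤-refl , 1≤n
    row-bounds false = 1≤n , ≤-refl
    valid : ∀ {w} → w ∈ staircase n t → ValidWall n m w
    valid w∈ with staircase-member w∈
    ... | suc s , _ , s≤t , refl =
      row-bounds (isOdd (suc s)) , s≤s z≤n , ≤-trans (s≤s (twice-mono s≤t)) 2t<m

-- The staircase of t ≥ 1 walls solves G_{n,m} whenever n ≥ 2 and 2t < m ≤ 2t + 2.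
-- Invariant: column 2s is reached in row wallRow n s (by a right move stopped by
-- wall s), column 2s + 1 in the same row (by a left move from column 2s + 2,
-- stopped by wall s); the last run to the right ends on column m.
module StaircaseSolves (n m t : ℕ) (2≤n : 2 ≤ n) (1≤t : 1 ≤ t)
                       (2t<m : twice t < m) (m≤2t+2 : m ≤ 2 + twice t) where

  private
    W : List Wall
    W = staircase n t

    ρ : ℕ → ℕ
    ρ = wallRow n

    R : Square → Set
    R = Reach n m W

    1≤n : 1 ≤ n
    1≤n = ≤-trans (s≤s z≤n) 2≤n

    n≢1 : n ≢ 1
    n≢1 n≡1 = <⇒≢ 2≤n (sym n≡1)

  switch : ∀ s s' j → R (ρ s , j) → R (ρ s' , j)
  switch s s' = switch-row staircase-noHor 1≤n (isOdd s) (isOdd s')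

  col<m : ∀ {s} → s ≤ t → twice s < m
  col<m s≤t = ≤-trans (s≤s (twice-mono s≤t)) 2t<m

  open-even : ∀ s → s ≤ t → ¬ Blocked n m W right (ρ (suc s) , twice s)
  open-even s s≤t = [ <⇒≢ (col<m s≤t) , no-wrong-row n≢1 s ]

  open-odd : ∀ r s → suc (twice s) < m → ¬ Blocked n m W right (r , suc (twice s))
  open-odd r s 2s+1<m = [ <⇒≢ 2s+1<m , no-odd-wall ]

  open-left : ∀ r s → ¬ Blocked n m W left (r , twice (suc s))
  open-left r s = [ (λ ()) , no-odd-wall ]

  wall-right : ∀ s → 1 ≤ s → s ≤ t → Blocked n m W right (ρ s , twice s)
  wall-right s 1≤s s≤t = inj₂ (staircase-has 1≤s s≤t)

  wall-left : ∀ s → 1 ≤ s → s ≤ t → Blocked n m W left (ρ s , suc (twice s))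
  wall-left s 1≤s s≤t = inj₂ (staircase-has 1≤s s≤t)

  even-reach : ∀ s → 1 ≤ s → s ≤ t → R (ρ s , twice s)
  even-reach 1 _ 1≤t = move right start
    (go (open-odd 1 0 (≤-trans (n≤1+n 2) (col<m 1≤t))) (stop (wall-right 1 ≤-refl 1≤t)))
  even-reach (suc (suc s)) _ s+2≤t = move right
    (switch (suc s) (suc (suc s)) _ (even-reach (suc s) (s≤s z≤n) (<⇒≤ s+2≤t)))
    (go (open-even (suc s) (<⇒≤ s+2≤t))
      (go (open-odd _ (suc s) (≤-trans (n≤1+n _) (col<m s+2≤t)))
        (stop (wall-right (suc (suc s)) (s≤s z≤n) s+2≤t))))

  odd-reach : ∀ s → 1 ≤ s → s < t → R (ρ s , suc (twice s))
  odd-reach s 1≤s s<t = move left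
    (switch (suc s) s _ (even-reach (suc s) (s≤s z≤n) s<t))
    (go (open-left _ s) (stop (wall-left s 1≤s (<⇒≤ s<t))))

  last-even : R (ρ (suc t) , twice t)
  last-even = switch t (suc t) _ (even-reach t 1≤t ≤-refl)

  final : R (ρ (suc t) , m) × R (ρ t , suc (twice t))
  final with m≤n⇒m<n∨m≡n m≤2t+2
  ... | inj₁ m<2t+2 with ≤-antisym (≤-pred m<2t+2) 2t<m
  ...   | refl = to-m , switch (suc t) t _ to-m
    where
      to-m : R (ρ (suc t) , suc (twice t))
      to-m = move right last-even (go (open-even t ≤-refl) (stop (inj₁ refl)))
  final | inj₂ refl = to-m , move left (switch (suc t) t _ to-m)
                               (go (open-left _ t) (stop (wall-left t 1≤t ≤-refl)))
    where
      to-m : R (ρ (suc t) , 2 + twice t)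
      to-m = move right last-even (go (open-even t ≤-refl) (go (open-odd _ t ≤-refl) (stop (inj₁ refl))))

  column-reach : ∀ j → 1 ≤ j → j ≤ m → Σ Bool λ b → R (rowOf n b , j)
  column-reach j 1≤j j≤m with parity j
  ... | even zero = contradiction 1≤j λ ()
  ... | odd zero  = true , start
  ... | even (suc s) with suc s ≤? t
  ...   | yes s+1≤t = isOdd (suc s) , even-reach (suc s) (s≤s z≤n) s+1≤t
  ...   | no  s+1≰t = isOdd (suc t) , subst (λ c → R (ρ (suc t) , c)) (sym j≡m) (proj₁ final)
    where
      j≡m : twice (suc s) ≡ m
      j≡m = ≤-antisym j≤m (≤-trans m≤2t+2 (twice-mono (≰⇒> s+1≰t)))
  column-reach j 1≤j j≤m | odd (suc s) with <-cmp (suc s) t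
  ... | tri< s+1<t _ _ = isOdd (suc s) , odd-reach (suc s) (s≤s z≤n) s+1<t
  ... | tri≈ _ refl _  = isOdd (suc s) , proj₂ final
  ... | tri> _ _ t<s+1 = contradiction (≤-trans j≤m (≤-trans m≤2t+2 (twice-mono t<s+1))) 1+n≰n

  solution : Solution n m W
  solution i j 1≤i i≤n 1≤j j≤m with column-reach j 1≤j j≤m
  ... | b , r = sweep-column staircase-noHor 1≤n b j r i 1≤i i≤n

opt-wide : ∀ n m → 3 ≤ m → m ≤ n → OptPW≡ n m ⌈ (m ∸ 2) /2⌉
opt-wide n 1 (s≤s ()) _
opt-wide n 2 (s≤s (s≤s ())) _
opt-wide n (suc (suc (suc k))) _ m≤n =
  (staircase n t , staircase-wallSet n m t 1≤n 2t<m , solution , length-staircase n t) ,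
  λ W _ sol → lower-bound n (suc k) W m≤n sol
  where
    m = 3 + k
    t = ⌈ suc k /2⌉
    1≤n : 1 ≤ n
    1≤n = ≤-trans (s≤s z≤n) m≤n
    2t<m : twice t < m
    2t<m = s≤s (proj₂ (twice-ceil (suc k)))
    open StaircaseSolves n m t (≤-trans (s≤s (s≤s z≤n)) m≤n) (s≤s z≤n) 2t<m
                         (s≤s (s≤s (proj₁ (twice-ceil (suc k)))))

opt-narrow : ∀ n m → 1 ≤ m → m ≤ 2 → m ≤ n → OptPW≡ n m 0
opt-narrow n m 1≤m m≤2 m≤n = ([] , ([] , []) , solution , refl) , λ _ _ _ → z≤n
  where
    no-hor : NoHor []
    no-hor ()
    top-reach : ∀ j → 1 ≤ j → j ≤ m → Reach n m [] (1 , j)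
    top-reach 1 _ _   = start
    top-reach 2 _ 2≤m =
      move right start (go [ <⇒≢ 2≤m , (λ ()) ] (stop (inj₁ (≤-antisym 2≤m m≤2))))
    top-reach (suc (suc (suc j))) _ j≤m = contradiction (≤-trans j≤m m≤2) λ { (s≤s (s≤s ())) }
    solution : Solution n m []
    solution i j 1≤i i≤n 1≤j j≤m =
      sweep-column no-hor (≤-trans 1≤m m≤n) true j (top-reach j 1≤j j≤m) i 1≤i i≤n

mainTheorem12 : (∀ n m → 4 ≤ m → m ≤ n → OptPW≡ n m ⌈ (m ∸ 2) /2⌉)
    × (∀ n → 3 ≤ n → OptPW≡ n 3 1)
    × (∀ n m → 1 ≤ m → m ≤ 2 → m ≤ n → OptPW≡ n m 0)
mainTheorem12 =
  (λ n m 4≤m → opt-wide n m (≤-trans (n≤1+n 3) 4≤m)) ,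
  (λ n → opt-wide n 3 ≤-refl) ,
  opt-narrow
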